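{- Let $G$ be a simple graph containing a path with consecutive vertices $v_1,\dots,v_n$ such that $v_2,\dots,v_{n-1}$ all have degree 2 in $G$, and let $p$ be a pebble distribution on $G$ such that $p(v_1)=0=p(v_n)$, $p(v_i)\ge2$ for some $i\in\{2,\dots,n-1\}$, and $p(v_j)\ge1$ for all $j\in\{2,\dots,n-1\}$. Let $q$ be obtained from $p$ by the double rolling move from $v_i$ to $v_1$ and $v_n$, i.e. $q(v_i)=p(v_i)-2$, $q(v_1)=1$, $q(v_n)=1$ and $q(x)=p(x)$ for all other $x$. If a vertex $u\in V(G)$ is reachable from $p$, then $u$ is also reachable from $q$.
   Context: A pebble distribution on $G$ is a function $p:V(G)\to\mathbb{Z}_{\ge0}$. If $\{a,b\}\in E(G)$, the pebbling move $(a,a\to b)$ removes two pebbles at $a$ and adds one at $b$. If $a\ne c$ and $\{a,b\},\{c,b\}\in E(G)$, the strict rubbling move $(a,c\to b)$ removes one pebble at each of $a$ and $c$ and adds one at $b$. A rubbling move is either of these. A vertex $x$ is reachable from $p$ if there is a sequence of rubbling moves, with pebble counts never becoming negative, after which $x$ has at least one pebble. -}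

module Defs where

open import Data.Nat using (ℕ; zero; suc; _+_; _∸_; _≤_)
open import Data.Fin using (Fin; _≟_)
open import Data.Bool using (Bool; true; false; if_then_else_)
open import Data.List using (List; map; allFin)
open import Data.Nat.ListAction using (sum)
open import Data.Product using (Σ; ∃; _×_; _,_)
open import Relation.Nullary using (does)
open import Relation.Binary.PropositionalEquality using (_≡_)
open import Relation.Binary.Construct.Closure.ReflexiveTransitive using (Star)

record SimpleGraph (N : ℕ) : Set where
  field
    adj   : Fin N → Fin N → Bool
    sym   : ∀ x y → adj x y ≡ adj y x
    loopless : ∀ x → adj x x ≡ false
open SimpleGraph public

degree : ∀ {N} → SimpleGraph N → Fin N → ℕ
degree {N} G v = sum (map (λ w → if adj G v w then 1 else 0) (allFin N))

Distribution : ℕ → Set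
Distribution N = Fin N → ℕ

δ : ∀ {N} → Fin N → Fin N → ℕ
δ a x = if does (x ≟ a) then 1 else 0

applyMove : ∀ {N} → Distribution N → Fin N → Fin N → Fin N → Distribution N
applyMove p a c b x = (p x ∸ (δ a x + δ c x)) + δ b x

-- One rubbling move: pebbling move when a = c, strict rubbling move when
-- a ≠ c.  Requires {a,b},{c,b} ∈ E(G) and that no count becomes negative.
data Step {N} (G : SimpleGraph N) (p : Distribution N) : Distribution N → Set where
  move : ∀ a c b → adj G a b ≡ true → adj G c b ≡ true →
         (∀ x → δ a x + δ c x ≤ p x) →
         Step G p (applyMove p a c b)

Reachable : ∀ {N} → SimpleGraph N → Distribution N → Fin N → Set
Reachable G p x = ∃ λ q → Star (λ r s → Step G r s) p q × (1 ≤ q x)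

-- A way to reach u from p is a binary tree of rubbling moves whose leaves are pebbles of p.
-- Follow a pebble that starts at v_i up such a tree: while it sits on an inner path vertex the
-- only moves available to it lead to neighbours on the path, so either u itself is an inner
-- vertex (and inner vertices are reachable from q outright) or the pebble first leaves the
-- inner path through a move into v_1 or v_n.  Cutting that move out of the tree, and using the
-- new pebble of q at that end instead, frees a pebble at v_i.  Doing this twice frees the two
-- pebbles of v_i that q lacks; when both cuts land on the same end, the two remaining halves of
-- the cut moves are recombined into a single move so that only one new pebble is spent there.
module Submission where

open import Defs renaming (sym to adj-sym)
open import Data.Nat using (ℕ; zero; suc; _+_; _∸_; _≤_; _<_; z≤n; s≤s; _≤?_)
open import Data.Nat.Properties hiding (_≟_)
open import Data.Nat.ListAction using (sum)
open import Data.Nat.Tactic.RingSolver using (solve-∀)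
open import Algebra.Properties.CommutativeSemigroup +-commutativeSemigroup using (interchange; xy∙z≈xz∙y)
open import Data.Fin using (Fin; zero; suc; fromℕ; fromℕ<; inject₁; toℕ; _≟_)
open import Data.Fin.Properties using (toℕ-injective; toℕ-inject₁; toℕ-fromℕ<; toℕ-fromℕ; toℕ<n)
open import Data.Bool using (true; if_then_else_)
open import Data.List using (map; allFin)
open import Data.List.Properties using (map-tabulate)
open import Data.Product using (Σ; ∃; _×_; _,_)
open import Data.Sum using (_⊎_; inj₁; inj₂)
open import Data.Empty using (⊥-elim)
open import Function using (_∘_; id)
open import Function.Definitions using (Injective)
open import Relation.Nullary using (¬_; yes; no)
open import Relation.Binary.PropositionalEquality
open import Relation.Binary.Construct.Closure.ReflexiveTransitive using (Star; ε; _◅_; _◅◅_)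

δ-self : ∀ {N} (a : Fin N) → δ a a ≡ 1
δ-self a with a ≟ a
... | yes _ = refl
... | no a≢a = ⊥-elim (a≢a refl)

δ-other : ∀ {N} (a x : Fin N) → x ≢ a → δ a x ≡ 0
δ-other a x x≢a with x ≟ a
... | yes x≡a = ⊥-elim (x≢a x≡a)
... | no _ = refl

1≤δ⇒≡ : ∀ {N} (a x : Fin N) → 1 ≤ δ a x → x ≡ a
1≤δ⇒≡ a x 1≤δ with x ≟ a
... | yes x≡a = x≡a
1≤δ⇒≡ a x () | no _

δ≤ : ∀ {N} (f : Fin N → ℕ) (a : Fin N) → 1 ≤ f a → ∀ x → δ a x ≤ f x
δ≤ f a 1≤fa x with x ≟ a
... | yes refl = 1≤fa
... | no _ = z≤n

spare-at : ∀ {N} (w : Fin N) (f b : Distribution N) → (∀ x → f x ≤ b x) → f w + 2 ≤ b w →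
           ∀ x → f x + (δ w x + δ w x) ≤ b x
spare-at w f b f≤b spare x with x ≟ w
... | yes refl = spare
... | no _ = subst (_≤ b x) (sym (+-identityʳ (f x))) (f≤b x)

1≤m+n⇒1≤n : ∀ {m n} → 1 ≤ m + n → ¬ 1 ≤ m → 1 ≤ n
1≤m+n⇒1≤n {zero} 1≤n _ = 1≤n
1≤m+n⇒1≤n {suc m} _ m≱1 = ⊥-elim (m≱1 (s≤s z≤n))

∑ : ∀ {n} → (Fin n → ℕ) → ℕ
∑ {n} f = sum (map f (allFin n))

∑-suc : ∀ {n} (f : Fin (suc n) → ℕ) → ∑ f ≡ f zero + ∑ (f ∘ suc)
∑-suc f = cong (λ fs → f zero + sum fs) (trans (map-tabulate suc f) (sym (map-tabulate id (f ∘ suc))))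

∑-mono : ∀ {n} {f g : Fin n → ℕ} → (∀ x → f x ≤ g x) → ∑ f ≤ ∑ g
∑-mono {zero} f≤g = z≤n
∑-mono {suc n} {f} {g} f≤g rewrite ∑-suc f | ∑-suc g =
  +-mono-≤ (f≤g zero) (∑-mono (f≤g ∘ suc))

∑-+ : ∀ {n} (f g : Fin n → ℕ) → ∑ (λ x → f x + g x) ≡ ∑ f + ∑ g
∑-+ {zero} f g = refl
∑-+ {suc n} f g rewrite ∑-suc (λ x → f x + g x) | ∑-suc f | ∑-suc g | ∑-+ (f ∘ suc) (g ∘ suc) =
  interchange (f zero) (g zero) (∑ (f ∘ suc)) (∑ (g ∘ suc))

≤∑ : ∀ {n} (f : Fin n → ℕ) (y : Fin n) → f y ≤ ∑ f
≤∑ f zero rewrite ∑-suc f = m≤m+n (f zero) _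
≤∑ f (suc y) rewrite ∑-suc f = ≤-trans (≤∑ (f ∘ suc) y) (m≤n+m _ (f zero))

1≤∑δ : ∀ {n} (a : Fin n) → 1 ≤ ∑ (δ a)
1≤∑δ a = subst (_≤ ∑ (δ a)) (δ-self a) (≤∑ (δ a) a)

module _ {N : ℕ} (G : SimpleGraph N) where

  3≤degree : ∀ {x a b c} → a ≢ b → a ≢ c → b ≢ c →
             adj G x a ≡ true → adj G x b ≡ true → adj G x c ≡ true → 3 ≤ degree G x
  3≤degree {x} {a} {b} {c} a≢b a≢c b≢c x→a x→b x→c = begin
    3                                ≤⟨ +-mono-≤ (+-mono-≤ (1≤∑δ a) (1≤∑δ b)) (1≤∑δ c) ⟩
    ∑ (δ a) + ∑ (δ b) + ∑ (δ c)      ≡⟨ sym (trans (∑-+ _ (δ c)) (cong (_+ ∑ (δ c)) (∑-+ (δ a) (δ b)))) ⟩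
    ∑ (λ y → δ a y + δ b y + δ c y)  ≤⟨ ∑-mono indicators≤adj ⟩
    degree G x                       ∎
    where
    open ≤-Reasoning
    adj⇒1 : ∀ {y} → adj G x y ≡ true → (if adj G x y then 1 else 0) ≡ 1
    adj⇒1 x→y rewrite x→y = refl
    indicators≤adj : ∀ y → δ a y + δ b y + δ c y ≤ (if adj G x y then 1 else 0)
    indicators≤adj y with y ≟ a | y ≟ b | y ≟ c
    ... | yes refl | yes refl | _        = ⊥-elim (a≢b refl)
    ... | yes refl | _        | yes refl = ⊥-elim (a≢c refl)
    ... | _        | yes refl | yes refl = ⊥-elim (b≢c refl)
    ... | yes refl | no _     | no _     = ≤-reflexive (sym (adj⇒1 x→a))
    ... | no _     | yes refl | no _     = ≤-reflexive (sym (adj⇒1 x→b))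
    ... | no _     | no _     | yes refl = ≤-reflexive (sym (adj⇒1 x→c))
    ... | no _     | no _     | no _     = z≤n

  degree≡2⇒neighbour : ∀ {x a b c} → degree G x ≡ 2 → a ≢ b →
                       adj G x a ≡ true → adj G x b ≡ true → adj G x c ≡ true → c ≡ a ⊎ c ≡ b
  degree≡2⇒neighbour {x} {a} {b} {c} deg≡2 a≢b x→a x→b x→c with c ≟ a | c ≟ b
  ... | yes c≡a | _       = inj₁ c≡a
  ... | no _    | yes c≡b = inj₂ c≡b
  ... | no c≢a  | no c≢b  =
    ⊥-elim (<-irrefl refl (subst (3 ≤_) deg≡2 (3≤degree a≢b (c≢a ∘ sym) (c≢b ∘ sym) x→a x→b x→c)))

  adj-flip : ∀ {x y} → adj G x y ≡ true → adj G y x ≡ true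
  adj-flip {x} {y} x→y = trans (adj-sym G y x) x→y

  occupied⇒reachable : ∀ {p u} → 1 ≤ p u → Reachable G p u
  occupied⇒reachable {p} 1≤pu = p , ε , 1≤pu

  neighbours⇒reachable : ∀ {p a c u} → a ≢ c → adj G a u ≡ true → adj G c u ≡ true →
                         1 ≤ p a → 1 ≤ p c → Reachable G p u
  neighbours⇒reachable {p} {a} {c} {u} a≢c a→u c→u 1≤pa 1≤pc =
    applyMove p a c u , move a c u a→u c→u a+c≤p ◅ ε ,
    subst (λ n → 1 ≤ p u ∸ (δ a u + δ c u) + n) (sym (δ-self u)) (m≤n+m 1 _)
    where
    a+c≤p : ∀ x → δ a x + δ c x ≤ p x
    a+c≤p x with x ≟ a | x ≟ c
    ... | yes refl | yes refl = ⊥-elim (a≢c refl)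
    ... | yes refl | no _     = 1≤pa
    ... | no _     | yes refl = 1≤pc
    ... | no _     | no _     = z≤n

module RubblingTrees {N : ℕ} (G : SimpleGraph N) where

  -- node b A C is the move (a, c → b) applied to the pebbles produced by A and C; the leaves
  -- are the pebbles of the initial distribution that the whole tree consumes.
  data Tree : Fin N → Set where
    leaf : ∀ x → Tree x
    node : ∀ {a c} b → adj G a b ≡ true → adj G c b ≡ true → Tree a → Tree c → Tree b

  leaves : ∀ {r} → Tree r → Distribution N
  leaves (leaf y) = δ y
  leaves (node _ _ _ A C) x = leaves A x + leaves C x

  data Context : Fin N → Fin N → Set where
    hole  : ∀ {h} → Context h h
    nodeˡ : ∀ {a c h} b → adj G a b ≡ true → adj G c b ≡ true → Context a h → Tree c → Context b h
    nodeʳ : ∀ {a c h} b → adj G a b ≡ true → adj G c b ≡ true → Tree a → Context c h → Context b h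

  plug : ∀ {r h} → Context r h → Tree h → Tree r
  plug hole S = S
  plug (nodeˡ b a→b c→b K C) S = node b a→b c→b (plug K S) C
  plug (nodeʳ b a→b c→b A K) S = node b a→b c→b A (plug K S)

  contextLeaves : ∀ {r h} → Context r h → Distribution N
  contextLeaves hole x = 0
  contextLeaves (nodeˡ _ _ _ K C) x = contextLeaves K x + leaves C x
  contextLeaves (nodeʳ _ _ _ A K) x = leaves A x + contextLeaves K x

  leaves-plug : ∀ {r h} (K : Context r h) (S : Tree h) x →
                leaves (plug K S) x ≡ contextLeaves K x + leaves S x
  leaves-plug hole S x = refl
  leaves-plug (nodeˡ _ _ _ K C) S x rewrite leaves-plug K S x =
    xy∙z≈xz∙y (contextLeaves K x) (leaves S x) (leaves C x)
  leaves-plug (nodeʳ _ _ _ A K) S x rewrite leaves-plug K S x =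
    sym (+-assoc (leaves A x) (contextLeaves K x) (leaves S x))

  leaves-plug-swap : ∀ {r h} (K : Context r h) (S R : Tree h) x →
                     leaves (plug K S) x + leaves R x ≡ leaves (plug K R) x + leaves S x
  leaves-plug-swap K S R x rewrite leaves-plug K S x | leaves-plug K R x =
    xy∙z≈xz∙y (contextLeaves K x) (leaves S x) (leaves R x)

  Steps : Distribution N → Distribution N → Set
  Steps = Star (λ r s → Step G r s)

  -- Invariant: the pebbles counted by rest are never touched.
  execute : ∀ {r} (t : Tree r) (p rest : Distribution N) → (∀ x → leaves t x + rest x ≤ p x) →
            ∃ λ s → Steps p s × (∀ x → rest x + δ r x ≤ s x)
  execute (leaf y) p rest fits = p , ε , λ x → subst (_≤ p x) (+-comm (δ y x) (rest x)) (fits x)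
  execute (node {a} {c} b a→b c→b A C) p rest fits
    with execute A p (λ x → leaves C x + rest x)
           (λ x → subst (_≤ p x) (+-assoc (leaves A x) (leaves C x) (rest x)) (fits x))
  ... | s₁ , p→s₁ , fits₁
    with execute C s₁ (λ x → rest x + δ a x)
           (λ x → subst (_≤ s₁ x) (+-assoc (leaves C x) (rest x) (δ a x)) (fits₁ x))
  ... | s₂ , s₁→s₂ , fits₂ =
    applyMove s₂ a c b ,
    p→s₁ ◅◅ s₁→s₂ ◅◅ move a c b a→b c→b (λ x → ≤-trans (m≤n+m _ (rest x)) (rest+a+c≤s₂ x)) ◅ ε ,
    λ x → +-monoˡ-≤ (δ b x) (m+n≤o⇒m≤o∸n (rest x) (rest+a+c≤s₂ x))
    where
    rest+a+c≤s₂ : ∀ x → rest x + (δ a x + δ c x) ≤ s₂ x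
    rest+a+c≤s₂ x = subst (_≤ s₂ x) (+-assoc (rest x) (δ a x) (δ c x)) (fits₂ x)

  tree⇒reachable : ∀ {u} (t : Tree u) (p : Distribution N) → (∀ x → leaves t x ≤ p x) → Reachable G p u
  tree⇒reachable {u} t p t≤p
    with execute t p (λ _ → 0) (λ x → subst (_≤ p x) (sym (+-identityʳ _)) (t≤p x))
  ... | s , p→s , fits = s , p→s , subst (_≤ s u) (δ-self u) (fits u)

  expandLeaf : ∀ {r a c} b → adj G a b ≡ true → adj G c b ≡ true → (t : Tree r) → 1 ≤ leaves t b →
               Σ (Tree r) λ t′ → ∀ x → leaves t′ x + δ b x ≡ leaves t x + (δ a x + δ c x)
  expandLeaf {a = a} {c} b a→b c→b (leaf y) 1≤δ with 1≤δ⇒≡ y b 1≤δ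
  ... | refl = node b a→b c→b (leaf a) (leaf c) , λ x → +-comm (δ a x + δ c x) (δ b x)
  expandLeaf {a = a} {c} b a→b c→b (node y a→y c→y A C) 1≤AC with 1 ≤? leaves A b
  ... | yes 1≤A with expandLeaf b a→b c→b A 1≤A
  ...   | A′ , A′-eq = node y a→y c→y A′ C , λ x →
    begin
      leaves A′ x + leaves C x + δ b x   ≡⟨ xy∙z≈xz∙y (leaves A′ x) (leaves C x) (δ b x) ⟩
      leaves A′ x + δ b x + leaves C x   ≡⟨ cong (_+ leaves C x) (A′-eq x) ⟩
      leaves A x + (δ a x + δ c x) + leaves C x   ≡⟨ xy∙z≈xz∙y (leaves A x) (δ a x + δ c x) (leaves C x) ⟩
      leaves A x + leaves C x + (δ a x + δ c x)   ∎
    where open ≡-Reasoning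
  expandLeaf {a = a} {c} b a→b c→b (node y a→y c→y A C) 1≤AC | no A≱1
    with expandLeaf b a→b c→b C (1≤m+n⇒1≤n 1≤AC A≱1)
  ... | C′ , C′-eq = node y a→y c→y A C′ , λ x →
    trans (+-assoc (leaves A x) (leaves C′ x) (δ b x))
      (trans (cong (leaves A x +_) (C′-eq x)) (sym (+-assoc (leaves A x) (leaves C x) (δ a x + δ c x))))

  reachable⇒tree : ∀ {p s} → Steps p s → ∀ u → 1 ≤ s u → Σ (Tree u) λ t → ∀ x → leaves t x ≤ p x
  reachable⇒tree {p} ε u 1≤pu = leaf u , δ≤ p u 1≤pu
  reachable⇒tree {p} (move a c b a→b c→b a+c≤p ◅ rest) u 1≤su with reachable⇒tree rest u 1≤su
  ... | t , t≤p′ with 1 ≤? leaves t b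
  ... | no b-unused = t , t≤p
    where
    t≤p : ∀ x → leaves t x ≤ p x
    t≤p x with x ≟ b
    ... | yes refl = ≤-trans (≤-pred (≰⇒> b-unused)) z≤n
    ... | no x≢b = ≤-trans (t≤p′ x) (subst (λ n → p x ∸ (δ a x + δ c x) + n ≤ p x) (sym (δ-other b x x≢b))
                     (≤-trans (≤-reflexive (+-identityʳ _)) (m∸n≤m (p x) (δ a x + δ c x))))
  ... | yes b-used with expandLeaf b a→b c→b t b-used
  ...   | t′ , t′-eq = t′ , λ x → +-cancelʳ-≤ (δ b x) (leaves t′ x) (p x) (begin
      leaves t′ x + δ b x                        ≡⟨ t′-eq x ⟩
      leaves t x + (δ a x + δ c x)               ≤⟨ +-monoˡ-≤ _ (t≤p′ x) ⟩
      p x ∸ (δ a x + δ c x) + δ b x + (δ a x + δ c x)   ≡⟨ xy∙z≈xz∙y (p x ∸ (δ a x + δ c x)) (δ b x) _ ⟩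
      p x ∸ (δ a x + δ c x) + (δ a x + δ c x) + δ b x   ≡⟨ cong (_+ δ b x) (m∸n+n≡m (a+c≤p x)) ⟩
      p x + δ b x                                ∎)
    where open ≤-Reasoning

module Rolling {N : ℕ} (G : SimpleGraph N) (Interior : Fin N → Set) (w e₀ e₁ : Fin N)
  (w-interior : Interior w)
  (interior-closed : ∀ {x b} → Interior x → adj G x b ≡ true → Interior b ⊎ b ≡ e₀ ⊎ b ≡ e₁)
  where

  open RubblingTrees G

  IsEnd : Fin N → Set
  IsEnd e = e ≡ e₀ ⊎ e ≡ e₁

  end-≤ : ∀ {e} → IsEnd e → ∀ x → δ e x ≤ δ e₀ x + δ e₁ x
  end-≤ (inj₁ refl) x = m≤m+n _ _
  end-≤ (inj₂ refl) x = m≤n+m _ _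

  distinct-ends-≤ : ∀ {e e′} → IsEnd e → IsEnd e′ → e ≢ e′ → ∀ x → δ e x + δ e′ x ≤ δ e₀ x + δ e₁ x
  distinct-ends-≤ (inj₁ refl) (inj₁ refl) e≢e′ = ⊥-elim (e≢e′ refl)
  distinct-ends-≤ (inj₁ refl) (inj₂ refl) _ x = ≤-refl
  distinct-ends-≤ (inj₂ refl) (inj₁ refl) _ x = ≤-reflexive (+-comm (δ e₁ x) (δ e₀ x))
  distinct-ends-≤ (inj₂ refl) (inj₂ refl) e≢e′ = ⊥-elim (e≢e′ refl)

  -- t is K[node e A B] only up to the order of children, hence the equation of leaves.
  record Exit {r} (t : Tree r) : Set where
    constructor exit
    field
      e     : Fin N
      e-end : IsEnd e
      K     : Context r e
      a b   : Fin N
      A     : Tree a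
      B     : Tree b
      a→e   : adj G a e ≡ true
      b→e   : adj G b e ≡ true
      A-w   : 1 ≤ leaves A w
      split : ∀ x → leaves t x ≡ leaves (plug K (node e a→e b→e A B)) x

  shortcut : ∀ {r} {t : Tree r} → Exit t → Tree r
  shortcut X = plug K (leaf e) where open Exit X

  shortcut-leaves : ∀ {r} {t : Tree r} (X : Exit t) → let open Exit X in
                    ∀ x → leaves (shortcut X) x + (leaves A x + leaves B x) ≡ leaves t x + δ e x
  shortcut-leaves X x =
    trans (leaves-plug-swap K (leaf e) (node e a→e b→e A B) x) (cong (_+ δ e x) (sym (split x)))
    where open Exit X

  w≤A : ∀ {r} {t : Tree r} (X : Exit t) → ∀ x → δ w x ≤ leaves (Exit.A X) x
  w≤A X = δ≤ (leaves A) w A-w where open Exit X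

  exitˡ : ∀ {a c b} {a→b : adj G a b ≡ true} {c→b : adj G c b ≡ true} {A : Tree a} (C : Tree c) →
          Exit A → Exit (node b a→b c→b A C)
  exitˡ {a→b = a→b} {c→b} C (exit e e-end K _ _ A′ B′ a→e b→e A′-w split) =
    exit e e-end (nodeˡ _ a→b c→b K C) _ _ A′ B′ a→e b→e A′-w (λ x → cong (_+ leaves C x) (split x))

  exitʳ : ∀ {a c b} {a→b : adj G a b ≡ true} {c→b : adj G c b ≡ true} (A : Tree a) {C : Tree c} →
          Exit C → Exit (node b a→b c→b A C)
  exitʳ {a→b = a→b} {c→b} A (exit e e-end K _ _ A′ B′ a→e b→e A′-w split) =
    exit e e-end (nodeʳ _ a→b c→b A K) _ _ A′ B′ a→e b→e A′-w (λ x → cong (leaves A x +_) (split x))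

  find : ∀ {r} (t : Tree r) → 1 ≤ leaves t w → Interior r ⊎ Exit t
  find (leaf y) 1≤δ = inj₁ (subst Interior (1≤δ⇒≡ y w 1≤δ) w-interior)
  find (node b a→b c→b A C) 1≤AC with 1 ≤? leaves A w
  ... | yes A-w with find A A-w
  ...   | inj₂ X = inj₂ (exitˡ C X)
  ...   | inj₁ a-int with interior-closed a-int a→b
  ...     | inj₁ b-int = inj₁ b-int
  ...     | inj₂ b-end = inj₂ (exit b b-end hole _ _ A C a→b c→b A-w (λ _ → refl))
  find (node b a→b c→b A C) 1≤AC | no A≱1 with find C (1≤m+n⇒1≤n 1≤AC A≱1)
  ...   | inj₂ X = inj₂ (exitʳ A X)
  ...   | inj₁ c-int with interior-closed c-int c→b
  ...     | inj₁ b-int = inj₁ b-int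
  ...     | inj₂ b-end = inj₂ (exit b b-end hole _ _ C A c→b a→b (1≤m+n⇒1≤n 1≤AC A≱1)
                                 (λ x → +-comm (leaves A x) (leaves C x)))

  module _ (p : Distribution N) (2≤pw : 2 ≤ p w) where

    -- leaves t ≤ p − 2[w] + [e₀] + [e₁], with the subtraction moved to the left
    Fits : ∀ {u} → Tree u → Set
    Fits t = ∀ x → leaves t x + (δ w x + δ w x) ≤ p x + (δ e₀ x + δ e₁ x)

    tight⇒1≤ : ∀ {m} → ¬ m + 2 ≤ p w → 1 ≤ m
    tight⇒1≤ {zero} tight = ⊥-elim (tight 2≤pw)
    tight⇒1≤ {suc m} _ = s≤s z≤n

    shortcut-fits : ∀ {u} {t : Tree u} (X : Exit t) → (∀ x → leaves t x ≤ p x) →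
                    leaves (shortcut X) w + 2 ≤ p w → Fits (shortcut X)
    shortcut-fits X t≤p spare x =
      ≤-trans (spare-at w (leaves (shortcut X)) (λ y → p y + δ e y) shortcut≤ (≤-trans spare (m≤m+n _ _)) x)
              (+-monoʳ-≤ (p x) (end-≤ e-end x))
      where
      open Exit X
      shortcut≤ : ∀ y → leaves (shortcut X) y ≤ p y + δ e y
      shortcut≤ y = ≤-trans (m≤m+n _ _) (≤-trans (≤-reflexive (shortcut-leaves X y)) (+-monoˡ-≤ _ (t≤p y)))

    -- Two exits into the same end must share its one new pebble: the halves B, B₁ that did not
    -- come from w are recombined into a single move into that end.
    recombine : ∀ {u} {t : Tree u} (X : Exit t) (X₁ : Exit (shortcut X)) → Exit.e X₁ ≡ Exit.e X →
                (∀ x → leaves t x ≤ p x) → Σ (Tree u) Fits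
    recombine {t = t} X@(exit e e-end _ _ _ A B _ b→e _ _) X₁@(exit e _ K₁ _ _ A₁ B₁ a₁→e b₁→e _ split₁)
              refl t≤p =
      t₂ , λ x → begin
        leaves t₂ x + (δ w x + δ w x)            ≤⟨ +-monoʳ-≤ (leaves t₂ x) (+-mono-≤ (w≤A X₁ x) (w≤A X x)) ⟩
        leaves t₂ x + (leaves A₁ x + leaves A x) ≡⟨ merged (leaves t x) (leaves (shortcut X) x) (leaves t₂ x)
                                                     (leaves A x) (leaves B x) (leaves A₁ x) (leaves B₁ x) (δ e x)
                                                     (shortcut-leaves X x) (swap x) ⟩
        leaves t x + δ e x                       ≤⟨ +-mono-≤ (t≤p x) (end-≤ e-end x) ⟩
        p x + (δ e₀ x + δ e₁ x)                  ∎
      where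
      open ≤-Reasoning
      t₂ : Tree _
      t₂ = plug K₁ (node e b→e b₁→e B B₁)
      swap : ∀ x → leaves t₂ x + (leaves A₁ x + leaves B₁ x)
                 ≡ leaves (shortcut X) x + (leaves B x + leaves B₁ x)
      swap x = trans (leaves-plug-swap K₁ _ (node e a₁→e b₁→e A₁ B₁) x) (cong (_+ _) (sym (split₁ x)))
      merged : ∀ t t₁ t₂ a b a₁ b₁ d → t₁ + (a + b) ≡ t + d → t₂ + (a₁ + b₁) ≡ t₁ + (b + b₁) →
               t₂ + (a₁ + a) ≡ t + d
      merged t t₁ t₂ a b a₁ b₁ d first second = +-cancelʳ-≡ (b + b₁) _ _ (begin-equality
        t₂ + (a₁ + a) + (b + b₁)  ≡⟨ shuffle t₂ a₁ a b b₁ ⟩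
        t₂ + (a₁ + b₁) + (a + b)  ≡⟨ cong (_+ (a + b)) second ⟩
        t₁ + (b + b₁) + (a + b)   ≡⟨ xy∙z≈xz∙y t₁ (b + b₁) (a + b) ⟩
        t₁ + (a + b) + (b + b₁)   ≡⟨ cong (_+ (b + b₁)) first ⟩
        t + d + (b + b₁)          ∎)
        where
        shuffle : ∀ t₂ a₁ a b b₁ → t₂ + (a₁ + a) + (b + b₁) ≡ t₂ + (a₁ + b₁) + (a + b)
        shuffle = solve-∀

    cutBoth : ∀ {u} {t : Tree u} (X : Exit t) (X₁ : Exit (shortcut X)) → Exit.e X ≢ Exit.e X₁ →
              (∀ x → leaves t x ≤ p x) → Σ (Tree u) Fits
    cutBoth {t = t} X X₁ e≢e₁ t≤p = shortcut X₁ , λ x → begin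
      leaves t₂ x + (δ w x + δ w x)                ≤⟨ +-monoʳ-≤ (leaves t₂ x) (+-mono-≤ (w≤A X₁ x) (w≤A X x)) ⟩
      leaves t₂ x + (leaves X₁.A x + leaves X.A x) ≤⟨ sequential (leaves t x) (leaves (shortcut X) x) (leaves t₂ x)
                                                       (leaves X.A x) (leaves X.B x) (leaves X₁.A x) (leaves X₁.B x)
                                                       (δ X.e x) (δ X₁.e x)
                                                       (shortcut-leaves X x) (shortcut-leaves X₁ x) ⟩
      leaves t x + (δ X.e x + δ X₁.e x)            ≤⟨ +-mono-≤ (t≤p x) (distinct-ends-≤ X.e-end X₁.e-end e≢e₁ x) ⟩
      p x + (δ e₀ x + δ e₁ x)                      ∎
      where
      module X = Exit X
      module X₁ = Exit X₁
      open ≤-Reasoning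
      t₂ : Tree _
      t₂ = shortcut X₁
      sequential : ∀ t t₁ t₂ a b a₁ b₁ d d₁ → t₁ + (a + b) ≡ t + d → t₂ + (a₁ + b₁) ≡ t₁ + d₁ →
                   t₂ + (a₁ + a) ≤ t + (d + d₁)
      sequential t t₁ t₂ a b a₁ b₁ d d₁ first second = begin
        t₂ + (a₁ + a)                 ≤⟨ m≤m+n _ (b₁ + b) ⟩
        t₂ + (a₁ + a) + (b₁ + b)      ≡⟨ shuffle t₂ a₁ a b₁ b ⟩
        t₂ + (a₁ + b₁) + (a + b)      ≡⟨ cong (_+ (a + b)) second ⟩
        t₁ + d₁ + (a + b)             ≡⟨ xy∙z≈xz∙y t₁ d₁ (a + b) ⟩
        t₁ + (a + b) + d₁             ≡⟨ cong (_+ d₁) first ⟩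
        t + d + d₁                    ≡⟨ +-assoc t d d₁ ⟩
        t + (d + d₁)                  ∎
        where
        shuffle : ∀ t₂ a₁ a b₁ b → t₂ + (a₁ + a) + (b₁ + b) ≡ t₂ + (a₁ + b₁) + (a + b)
        shuffle = solve-∀

    roll : ∀ {u} (t : Tree u) → (∀ x → leaves t x ≤ p x) → Interior u ⊎ Σ (Tree u) Fits
    roll t t≤p with leaves t w + 2 ≤? p w
    ... | yes spare = inj₂ (t , λ x → ≤-trans (spare-at w (leaves t) p t≤p spare x) (m≤m+n (p x) _))
    ... | no tight with find t (tight⇒1≤ tight)
    ...   | inj₁ u-int = inj₁ u-int
    ...   | inj₂ X with leaves (shortcut X) w + 2 ≤? p w
    ...     | yes spare = inj₂ (shortcut X , shortcut-fits X t≤p spare)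
    ...     | no tight₁ with find (shortcut X) (tight⇒1≤ tight₁)
    ...       | inj₁ u-int = inj₁ u-int
    ...       | inj₂ X₁ with Exit.e X₁ ≟ Exit.e X
    ...         | yes same = inj₂ (recombine X X₁ same t≤p)
    ...         | no e₁≢e = inj₂ (cutBoth X X₁ (e₁≢e ∘ sym) t≤p)

  rolling-preserves-reachability : (p q : Distribution N) → 2 ≤ p w →
    (∀ x → p x + (δ e₀ x + δ e₁ x) ≤ q x + (δ w x + δ w x)) →
    (∀ {u} → Interior u → Reachable G q u) →
    ∀ u → Reachable G p u → Reachable G q u
  rolling-preserves-reachability p q 2≤pw p≤q interior-reachable u (_ , p→s , 1≤su)
    with reachable⇒tree p→s u 1≤su
  ... | t , t≤p with roll p 2≤pw t t≤p
  ...   | inj₁ u-int = interior-reachable u-int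
  ...   | inj₂ (t′ , fits) = tree⇒reachable t′ q λ x →
    +-cancelʳ-≤ (δ w x + δ w x) (leaves t′ x) (q x) (≤-trans (fits x) (p≤q x))

double-roll-balance : ∀ {N} {p q : Distribution N} {w e₀ e₁ : Fin N} →
  w ≢ e₀ → w ≢ e₁ → e₀ ≢ e₁ → 2 ≤ p w → p e₀ ≡ 0 → p e₁ ≡ 0 →
  q w ≡ p w ∸ 2 → q e₀ ≡ 1 → q e₁ ≡ 1 → (∀ x → x ≢ w → x ≢ e₀ → x ≢ e₁ → q x ≡ p x) →
  ∀ x → p x + (δ e₀ x + δ e₁ x) ≡ q x + (δ w x + δ w x)
double-roll-balance {p = p} {q} {w} {e₀} {e₁} w≢e₀ w≢e₁ e₀≢e₁ 2≤pw pe₀ pe₁ qw qe₀ qe₁ q-other x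
  with x ≟ w | x ≟ e₀ | x ≟ e₁
... | yes refl | yes w≡e₀ | _        = ⊥-elim (w≢e₀ w≡e₀)
... | yes refl | _        | yes w≡e₁ = ⊥-elim (w≢e₁ w≡e₁)
... | no _     | yes refl | yes refl = ⊥-elim (e₀≢e₁ refl)
... | yes refl | no _     | no _     = trans (+-identityʳ (p w)) (sym (trans (cong (_+ 2) qw) (m∸n+n≡m 2≤pw)))
... | no _     | yes refl | no _     = trans (cong (_+ 1) pe₀) (sym (cong (_+ 0) qe₀))
... | no _     | no _     | yes refl = trans (cong (_+ 1) pe₁) (sym (cong (_+ 0) qe₁))
... | no x≢w   | no x≢e₀  | no x≢e₁  = cong (_+ 0) (sym (q-other x x≢w x≢e₀ x≢e₁))

module Path {N : ℕ} (G : SimpleGraph N) (k : ℕ) (v : Fin (suc (suc k)) → Fin N)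
  (v-injective : Injective _≡_ _≡_ v)
  (v-edge : ∀ j → adj G (v (inject₁ j)) (v (suc j)) ≡ true)
  where

  first last : Fin N
  first = v zero
  last = v (fromℕ (suc k))

  Inner : Fin N → Set
  Inner x = ∃ λ j → 0 < toℕ j × toℕ j < suc k × v j ≡ x

  v-≢ : ∀ {j j′} → toℕ j ≢ toℕ j′ → v j ≢ v j′
  v-≢ j≢j′ = j≢j′ ∘ cong toℕ ∘ v-injective

  inner≢first : ∀ {j} → 0 < toℕ j → v j ≢ first
  inner≢first 0<j = v-≢ (<⇒≢ 0<j ∘ sym)

  inner≢last : ∀ {j} → toℕ j < suc k → v j ≢ last
  inner≢last j<k = v-≢ (λ j≡last → <⇒≢ j<k (trans j≡last (toℕ-fromℕ (suc k))))

  first≢last : first ≢ last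
  first≢last = v-≢ (λ 0≡last → 0≢1+n (trans 0≡last (toℕ-fromℕ (suc k))))

  path-vertex : ∀ j → Inner (v j) ⊎ v j ≡ first ⊎ v j ≡ last
  path-vertex zero = inj₂ (inj₁ refl)
  path-vertex (suc y) with suc y ≟ fromℕ (suc k)
  ... | yes j≡last = inj₂ (inj₂ (cong v j≡last))
  ... | no j≢last = inj₁ (suc y , s≤s z≤n , ≤∧≢⇒< (≤-pred (toℕ<n (suc y))) toℕ≢ , refl)
    where
    toℕ≢ : toℕ (suc y) ≢ suc k
    toℕ≢ e = j≢last (toℕ-injective (trans e (sym (toℕ-fromℕ (suc k)))))

  record Neighbours (j : Fin (suc (suc k))) : Set where
    field
      left right : Fin (suc (suc k))
      left→j     : adj G (v left) (v j) ≡ true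
      right→j    : adj G (v right) (v j) ≡ true
      left≢right : v left ≢ v right
      left≢j     : left ≢ j
      right≢j    : right ≢ j

  neighbours : ∀ {j} → 0 < toℕ j → toℕ j < suc k → Neighbours j
  neighbours {suc y} _ j<k = record
    { left       = inject₁ y
    ; right      = suc z
    ; left→j     = v-edge y
    ; right→j    = adj-flip G (subst (λ m → adj G (v m) (v (suc z)) ≡ true) z≡j (v-edge z))
    ; left≢right = v-≢ (λ e → m≢1+n+m (toℕ y) (trans (sym (toℕ-inject₁ y)) (trans e (cong suc toℕ-z))))
    ; left≢j     = λ e → 1+n≢n (sym (trans (sym (toℕ-inject₁ y)) (cong toℕ e)))
    ; right≢j    = λ e → 1+n≢n (trans (sym toℕ-z) (suc-injective (cong toℕ e)))
    }
    where
    z : Fin (suc k)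
    z = fromℕ< j<k
    toℕ-z : toℕ z ≡ suc (toℕ y)
    toℕ-z = toℕ-fromℕ< j<k
    z≡j : inject₁ z ≡ suc y
    z≡j = toℕ-injective (trans (toℕ-inject₁ z) toℕ-z)

  inner-closed : (∀ j → 0 < toℕ j → toℕ j < suc k → degree G (v j) ≡ 2) →
                 ∀ {x b} → Inner x → adj G x b ≡ true → Inner b ⊎ b ≡ first ⊎ b ≡ last
  inner-closed deg (j , 0<j , j<k , refl) j→b
    with neighbours 0<j j<k
  ... | record { left = l ; right = r ; left→j = l→j ; right→j = r→j ; left≢right = l≢r }
    with degree≡2⇒neighbour G (deg j 0<j j<k) l≢r (adj-flip G l→j) (adj-flip G r→j) j→b
  ...   | inj₁ refl = path-vertex l
  ...   | inj₂ refl = path-vertex r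

  inner-reachable : (q : Distribution N) (i : Fin (suc (suc k))) → (∀ j → j ≢ i → 1 ≤ q (v j)) →
                    ∀ {u} → Inner u → Reachable G q u
  inner-reachable q i q-pos (j , 0<j , j<k , refl) with j ≟ i
  ... | no j≢i = occupied⇒reachable G (q-pos j j≢i)
  ... | yes refl =
    neighbours⇒reachable G left≢right left→j right→j (q-pos left left≢j) (q-pos right right≢j)
    where open Neighbours (neighbours 0<j j<k)

  positive-except : ∀ {p q : Distribution N} i → (∀ j → 0 < toℕ j → toℕ j < suc k → 1 ≤ p (v j)) →
                 q first ≡ 1 → q last ≡ 1 → (∀ x → x ≢ v i → x ≢ first → x ≢ last → q x ≡ p x) →
                 ∀ j → j ≢ i → 1 ≤ q (v j)
  positive-except {q = q} i p-pos q-first q-last q-other j j≢i with path-vertex j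
  ... | inj₂ (inj₁ j-first) = ≤-reflexive (sym (trans (cong q j-first) q-first))
  ... | inj₂ (inj₂ j-last) = ≤-reflexive (sym (trans (cong q j-last) q-last))
  ... | inj₁ (j′ , 0<j′ , j′<k , vj′≡vj) with v-injective vj′≡vj
  ...   | refl = subst (1 ≤_) (sym (q-other (v j) (j≢i ∘ v-injective) (inner≢first 0<j′) (inner≢last j′<k)))
                   (p-pos j 0<j′ j′<k)

mainTheorem15 : ∀ {N : ℕ} (G : SimpleGraph N) (k : ℕ)
    (v : Fin (suc (suc k)) → Fin N)
    → Injective _≡_ _≡_ v
    → (∀ (j : Fin (suc k)) → adj G (v (inject₁ j)) (v (Data.Fin.suc j)) ≡ true)
    → (∀ (j : Fin (suc (suc k))) → 0 < toℕ j → toℕ j < suc k → degree G (v j) ≡ 2)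
    → (p : Distribution N)
    → p (v zero) ≡ 0
    → p (v (fromℕ (suc k))) ≡ 0
    → (i : Fin (suc (suc k))) → 0 < toℕ i → toℕ i < suc k → 2 ≤ p (v i)
    → (∀ (j : Fin (suc (suc k))) → 0 < toℕ j → toℕ j < suc k → 1 ≤ p (v j))
    → (q : Distribution N)
    → q (v i) ≡ p (v i) ∸ 2
    → q (v zero) ≡ 1
    → q (v (fromℕ (suc k))) ≡ 1
    → (∀ x → ¬ x ≡ v i → ¬ x ≡ v zero → ¬ x ≡ v (fromℕ (suc k)) → q x ≡ p x)
    → (u : Fin N) → Reachable G p u → Reachable G q u
mainTheorem15 G k v v-injective v-edge deg p p-first p-last i 0<i i<k 2≤pi p-inner
              q q-i q-first q-last q-other =
  rolling-preserves-reachability p q 2≤pi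
    (λ x → ≤-reflexive (double-roll-balance (inner≢first 0<i) (inner≢last i<k) first≢last 2≤pi
                          p-first p-last q-i q-first q-last q-other x))
    (inner-reachable q i (positive-except i p-inner q-first q-last q-other))
  where
  open Path G k v v-injective v-edge
  open Rolling G Inner (v i) first last (i , 0<i , i<k , refl) (inner-closed deg)
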